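{- Let $G$ be a connected $n$-node graph with diameter $D$ that admits tree-restricted $c$-congestion $b$-block partial shortcuts. Then $G$ admits tree-restricted $(c\log_2 n)$-congestion $b$-block shortcuts.
   Context: Let $T$ be a rooted spanning tree of $G$ and $P_1,\dots,P_k$ pairwise disjoint vertex sets each inducing a connected subgraph. For an index set $I\subseteq\{1,\dots,k\}$, a $T$-restricted $c$-congestion $b$-block shortcut for $\{P_i\}_{i\in I}$ is a family of edge sets $H_i\subseteq E(T)$, $i\in I$, such that every edge lies in at most $c$ of the $H_i$, and for each $i\in I$ the graph with vertex set $P_i\cup V(H_i)$ and edge set $H_i$ has at most $b$ connected components. $G$ admits tree-restricted $c$-congestion $b$-block shortcuts if for every rooted spanning tree $T$ of depth at most $D$ and every such collection $P_1,\dots,P_k$ there is such a shortcut with $I=\{1,\dots,k\}$; it admits tree-restricted $c$-congestion $b$-block partial shortcuts if for every such $T$ and $P_1,\dots,P_k$ there is such a shortcut for some $I$ with $|I|\ge k/2$. -}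

module Defs where

open import Data.Nat using (ℕ; zero; suc; _+_; _*_; _≤_)
open import Data.Fin using (Fin; zero; suc)
open import Data.Bool using (Bool; true; false; if_then_else_; _∧_)
open import Data.Product using (Σ; ∃; _×_; _,_)
open import Data.Sum using (_⊎_)
open import Data.List using (List; length)
open import Data.List.Membership.Propositional using (_∈_)
open import Data.List.Relation.Unary.All using (All)
open import Relation.Binary.PropositionalEquality using (_≡_; _≢_)
open import Relation.Binary.Construct.Closure.ReflexiveTransitive using (Star)

countTrue : ∀ {k} → (Fin k → Bool) → ℕ
countTrue {zero} f = 0
countTrue {suc k} f = (if f zero then 1 else 0) + countTrue (λ i → f (suc i))

iter : ∀ {A : Set} → (A → A) → ℕ → A → A
iter f zero x = x
iter f (suc m) x = f (iter f m x)

record Graph (n : ℕ) : Set where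
  field
    adj    : Fin n → Fin n → Bool
    sym    : ∀ u v → adj u v ≡ adj v u
    irrefl : ∀ v → adj v v ≡ false
open Graph public

Adj : ∀ {n} → Graph n → Fin n → Fin n → Set
Adj G u v = adj G u v ≡ true

data Walk {n} (G : Graph n) : ℕ → Fin n → Fin n → Set where
  here : ∀ {v} → Walk G zero v v
  step : ∀ {ℓ u v w} → Adj G u v → Walk G ℓ v w → Walk G (suc ℓ) u w

Connected : ∀ {n} → Graph n → Set
Connected G = ∀ u v → Star (Adj G) u v

IsDiameter : ∀ {n} → Graph n → ℕ → Set
IsDiameter {n} G D =
  (∀ u v → Σ ℕ λ ℓ → ℓ ≤ D × Walk G ℓ u v) ×
  (Σ (Fin n) λ u → Σ (Fin n) λ v → ∀ ℓ → Walk G ℓ u v → D ≤ ℓ)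

-- A rooted spanning tree of G of depth at most D, given by parent pointers:
-- its edges are {v , parent v} for v ≢ root; every vertex reaches the root
-- within D parent steps (so the structure is a tree of depth ≤ D).
record RootedSpanningTree {n} (G : Graph n) (D : ℕ) : Set where
  field
    root        : Fin n
    parent      : Fin n → Fin n
    parent-root : parent root ≡ root
    parent-adj  : ∀ v → v ≢ root → Adj G v (parent v)
    depth≤      : ∀ v → iter parent D v ≡ root
open RootedSpanningTree public

record Parts {n} (G : Graph n) (k : ℕ) : Set where
  field
    mem       : Fin k → Fin n → Bool
    disjoint  : ∀ i j v → i ≢ j → mem i v ≡ true → mem j v ≡ false
    nonempty  : ∀ i → Σ (Fin n) λ v → mem i v ≡ true
    connected : ∀ i u v → mem i u ≡ true → mem i v ≡ true →
                Star (λ x y → Adj G x y × mem i x ≡ true × mem i y ≡ true) u v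
open Parts public

module _ {n} {G : Graph n} {D : ℕ} (T : RootedSpanningTree G D) where

  -- a subset h of tree edges, encoded by child vertex: h v ≡ true means
  -- the edge {v , parent v} is present.  HEdge h x y : x,y joined by an edge of h.
  HEdge : (Fin n → Bool) → Fin n → Fin n → Set
  HEdge h x y = (h x ≡ true × y ≡ parent T x) ⊎ (h y ≡ true × x ≡ parent T y)

  InVert : (Fin n → Bool) → (Fin n → Bool) → Fin n → Set
  InVert p h x = p x ≡ true ⊎ (Σ (Fin n) λ y → HEdge h x y)

  -- the graph (P ∪ V(H), H) has at most b connected components:
  -- there are at most b vertices of it such that every vertex is joined by an
  -- H-path to one of them
  AtMostBlocks : (Fin n → Bool) → (Fin n → Bool) → ℕ → Set
  AtMostBlocks p h b =
    Σ (List (Fin n)) λ reps → length reps ≤ b × All (InVert p h) reps ×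
      (∀ x → InVert p h x → Σ (Fin n) λ r → r ∈ reps × Star (HEdge h) x r)

  -- T-restricted shortcut for {P_i}_{i ∈ I}, with congestion condition given by
  -- the predicate cong on the number of H_i containing an edge, and b blocks
  record Shortcut {k} (P : Parts G k) (I : Fin k → Bool) (cong : ℕ → Set) (b : ℕ) : Set where
    field
      H          : Fin k → Fin n → Bool
      H-tree     : ∀ i → H i (root T) ≡ false
      congestion : ∀ v → v ≢ root T → cong (countTrue (λ i → I i ∧ H i v))
      blocks     : ∀ i → I i ≡ true → AtMostBlocks (mem P i) (H i) b

AdmitsShortcuts : ∀ {n} → Graph n → ℕ → (ℕ → Set) → ℕ → Set
AdmitsShortcuts G D cong b =
  (T : RootedSpanningTree G D) (k : ℕ) (P : Parts G k) → Shortcut T P (λ _ → true) cong b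

AdmitsPartialShortcuts : ∀ {n} → Graph n → ℕ → (ℕ → Set) → ℕ → Set
AdmitsPartialShortcuts G D cong b =
  (T : RootedSpanningTree G D) (k : ℕ) (P : Parts G k) →
  Σ (Fin k → Bool) λ I → k ≤ 2 * countTrue I × Shortcut T P I cong b

{-# OPTIONS --safe #-}
module Submission where

-- Iterate the partial shortcuts: one round serves at least half of the parts that are
-- still unserved, so a family of k < 2^R parts is served completely after R rounds, at
-- congestion R·c.  A part with at most one vertex needs no shortcut edges (it is a single
-- block, and b ≥ 1 because the whole vertex set is itself a connected part), and parts with
-- at least two vertices number at most n/2; so R can be chosen with 2^R ≤ n, which gives
-- 2^congestion ≤ 2^(R·c) ≤ n^c.

open import Defs hiding (sym)
open import Data.Bool using (Bool; true; false; if_then_else_; _∧_; not)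
open import Data.Bool.Properties using (∧-zeroʳ; T-≡)
open import Data.Fin using (Fin; zero; suc)
open import Data.Fin.Properties using (toℕ<n) renaming (suc-injective to Fin-suc-injective)
open import Data.List using ([]; _∷_)
open import Data.List.Membership.Propositional using (_∈_)
open import Data.List.Membership.Propositional.Properties using (∈-length)
open import Data.List.Relation.Unary.All using ([]; _∷_)
open import Data.List.Relation.Unary.Any using (here)
open import Data.Nat using (ℕ; zero; suc; _+_; _*_; _^_; _≤_; _<_; z≤n; s≤s; s≤s⁻¹; _≤ᵇ_; _<?_)
open import Data.Nat.Properties
open import Data.Product using (Σ; ∃-syntax; _×_; _,_)
open import Data.Sum using (inj₁; inj₂)
open import Data.Vec.Functional using (tail)
open import Function using (_∘_; id; Equivalence)
open import Relation.Binary.Construct.Closure.ReflexiveTransitive using (Star; ε; gmap)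
open import Relation.Binary.PropositionalEquality
open import Relation.Nullary using (yes; no; contradiction)
open import Algebra.Properties.CommutativeMonoid.Sum +-0-commutativeMonoid
  using (sum; sum-syntax; ∑-comm; sum-cong-≗)
open import Algebra.Properties.CommutativeSemigroup +-commutativeSemigroup using (x∙yz≈y∙xz)

countTrue≡sum : ∀ {k} (f : Fin k → Bool) → countTrue f ≡ ∑[ i < k ] (if f i then 1 else 0)
countTrue≡sum {zero} f = refl
countTrue≡sum {suc k} f = cong ((if f zero then 1 else 0) +_) (countTrue≡sum (tail f))

countTrue-none : ∀ {k} (f : Fin k → Bool) → (∀ i → f i ≡ false) → countTrue f ≡ 0
countTrue-none {zero} f none = refl
countTrue-none {suc k} f none rewrite none zero = countTrue-none (tail f) (none ∘ suc)

countTrue-pos : ∀ {k} (f : Fin k → Bool) {i} → f i ≡ true → 1 ≤ countTrue f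
countTrue-pos f {zero} fi rewrite fi = s≤s z≤n
countTrue-pos f {suc i} fi = ≤-trans (countTrue-pos (tail f) fi) (m≤n+m _ _)

countTrue-if : ∀ {k} (I x y : Fin k → Bool) →
  countTrue (λ i → if I i then x i else y i) ≡
  countTrue (λ i → I i ∧ x i) + countTrue (λ i → not (I i) ∧ y i)
countTrue-if {zero} I x y = refl
countTrue-if {suc k} I x y = split-head (I zero) (x zero) (y zero) (countTrue-if (tail I) (tail x) (tail y))
  where
  bit : Bool → ℕ
  bit u = if u then 1 else 0
  split-head : ∀ b u v {A B C} → A ≡ B + C →
    bit (if b then u else v) + A ≡ (bit (b ∧ u) + B) + (bit (not b ∧ v) + C)
  split-head true  u v {B = B} {C} A≡B+C = trans (cong (bit u +_) A≡B+C) (sym (+-assoc (bit u) B C))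
  split-head false u v {B = B} {C} A≡B+C = trans (cong (bit v +_) A≡B+C) (x∙yz≈y∙xz (bit v) B C)

countTrue-not : ∀ {k} (I : Fin k → Bool) → countTrue I + countTrue (not ∘ I) ≡ k
countTrue-not {zero} I = refl
countTrue-not {suc k} I with I zero | countTrue-not (tail I)
... | true  | ih = cong suc ih
... | false | ih = trans (+-suc _ _) (cong suc ih)

countTrue≤1 : ∀ {k} (f : Fin k → Bool) → (∀ i j → i ≢ j → f i ≡ true → f j ≡ false) → countTrue f ≤ 1
countTrue≤1 {zero} f unique = z≤n
countTrue≤1 {suc k} f unique with f zero in f0
... | true  = ≤-reflexive (cong suc (countTrue-none (tail f) (λ i → unique zero (suc i) (λ ()) f0)))
... | false = countTrue≤1 (tail f) (λ i j i≢j → unique (suc i) (suc j) (i≢j ∘ Fin-suc-injective))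

countTrue≤1⇒unique : ∀ {k} (f : Fin k → Bool) → countTrue f ≤ 1 → ∀ {i j} → f i ≡ true → f j ≡ true → i ≡ j
countTrue≤1⇒unique f ≤1 {zero} {zero} _ _ = refl
countTrue≤1⇒unique f ≤1 {zero} {suc j} f0 fj rewrite f0 =
  contradiction (≤-trans (countTrue-pos (tail f) fj) (s≤s⁻¹ ≤1)) λ ()
countTrue≤1⇒unique f ≤1 {suc i} {zero} fi f0 rewrite f0 =
  contradiction (≤-trans (countTrue-pos (tail f) fi) (s≤s⁻¹ ≤1)) λ ()
countTrue≤1⇒unique f ≤1 {suc i} {suc j} fi fj =
  cong suc (countTrue≤1⇒unique (tail f) (≤-trans (m≤n+m _ _) ≤1) fi fj)

sum-mono-≤ : ∀ {k} {f g : Fin k → ℕ} → (∀ i → f i ≤ g i) → sum f ≤ sum g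
sum-mono-≤ {zero} f≤g = z≤n
sum-mono-≤ {suc k} f≤g = +-mono-≤ (f≤g zero) (sum-mono-≤ (f≤g ∘ suc))

sum-const : ∀ k m → ∑[ i < k ] m ≡ k * m
sum-const zero m = refl
sum-const (suc k) m = cong (m +_) (sum-const k m)

select : ∀ {k} (S : Fin k → Bool) → Fin (countTrue S) → Fin k
select {suc k} S j with S zero
... | true with j
...   | zero = zero
...   | suc j′ = suc (select (tail S) j′)
select {suc k} S j | false = suc (select (tail S) j)

select-true : ∀ {k} (S : Fin k → Bool) j → S (select S j) ≡ true
select-true {suc k} S j with S zero in S0
... | true with j
...   | zero = S0
...   | suc j′ = select-true (tail S) j′
select-true {suc k} S j | false = select-true (tail S) j

select-injective : ∀ {k} (S : Fin k → Bool) {j j′} → select S j ≡ select S j′ → j ≡ j′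
select-injective {suc k} S {j} {j′} eq with S zero
... | true with j | j′
...   | zero  | zero  = refl
...   | zero  | suc _ = contradiction eq λ ()
...   | suc _ | zero  = contradiction eq λ ()
...   | suc _ | suc _ = cong suc (select-injective (tail S) (Fin-suc-injective eq))
select-injective {suc k} S eq | false = select-injective (tail S) (Fin-suc-injective eq)

extend : ∀ {k} {A : Set} (S : Fin k → Bool) → (Fin (countTrue S) → A) → A → Fin k → A
extend {suc k} S g d i with S zero
extend {suc k} S g d zero    | true  = g zero
extend {suc k} S g d (suc i) | true  = extend (tail S) (g ∘ suc) d i
extend {suc k} S g d zero    | false = d
extend {suc k} S g d (suc i) | false = extend (tail S) g d i

extend-selected : ∀ {k} {A : Set} (S : Fin k → Bool) g d (Q : Fin k → A → Set) →
  (∀ j → Q (select S j) (g j)) → ∀ i → S i ≡ true → Q i (extend S g d i)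
extend-selected {suc k} S g d Q q zero S0 with S zero
extend-selected {suc k} S g d Q q zero S0 | true = q zero
extend-selected {suc k} S g d Q q zero () | false
extend-selected {suc k} S g d Q q (suc i) Si with S zero
... | true  = extend-selected (tail S) (g ∘ suc) d (Q ∘ suc) (q ∘ suc) i Si
... | false = extend-selected (tail S) g d (Q ∘ suc) q i Si

extend-unselected : ∀ {k} {A : Set} (S : Fin k → Bool) g (d : A) i → S i ≡ false → extend S g d i ≡ d
extend-unselected {suc k} S g d zero S0 with S zero
extend-unselected {suc k} S g d zero () | true
extend-unselected {suc k} S g d zero S0 | false = refl
extend-unselected {suc k} S g d (suc i) Si with S zero
... | true  = extend-unselected (tail S) (g ∘ suc) d i Si
... | false = extend-unselected (tail S) g d i Si

countTrue-extend : ∀ {k} {A : Set} (S : Fin k → Bool) (F : A → Bool) g d →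
  countTrue (λ i → S i ∧ F (extend S g d i)) ≡ countTrue (F ∘ g)
countTrue-extend {zero} S F g d = refl
countTrue-extend {suc k} S F g d with S zero
... | true  = cong ((if F (g zero) then 1 else 0) +_) (countTrue-extend (tail S) F (g ∘ suc) d)
... | false = countTrue-extend (tail S) F g d

complement-< : ∀ {a b k m} → a + b ≡ k → k ≤ 2 * a → k < 2 * m → b < m
complement-< {a} {b} {k} {m} a+b≡k k≤2a k<2m = *-cancelˡ-< 2 b m (begin-strict
  2 * b  ≡⟨ cong (b +_) (+-identityʳ b) ⟩
  b + b  ≤⟨ +-monoˡ-≤ b b≤a ⟩
  a + b  ≡⟨ a+b≡k ⟩
  k      <⟨ k<2m ⟩
  2 * m  ∎)
  where
  open ≤-Reasoning
  b≤a : b ≤ a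
  b≤a = +-cancelˡ-≤ a b a (begin
    a + b      ≡⟨ a+b≡k ⟩
    k          ≤⟨ k≤2a ⟩
    2 * a      ≡⟨ cong (a +_) (+-identityʳ a) ⟩
    a + a      ∎)

2^-between : ∀ {k n} → 1 ≤ n → 2 * k ≤ n → ∃[ R ] k < 2 ^ R × 2 ^ R ≤ n
2^-between {zero} 1≤n _ = 0 , s≤s z≤n , 1≤n
2^-between {suc k} {n} 1≤n 2k≤n with 2^-between {k} 1≤n (≤-trans (*-monoʳ-≤ 2 (n≤1+n k)) 2k≤n)
... | R , k<2^R , 2^R≤n with suc k <? 2 ^ R
...   | yes 1+k<2^R = R , 1+k<2^R , 2^R≤n
...   | no  1+k≮2^R = suc R , 1+k<2^1+R , 2^1+R≤n
  where
  2^R≡1+k : 2 ^ R ≡ suc k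
  2^R≡1+k = ≤-antisym (≮⇒≥ 1+k≮2^R) k<2^R
  1+k<2^1+R : suc k < 2 * 2 ^ R
  1+k<2^1+R rewrite 2^R≡1+k = m<m+n (suc k) (s≤s z≤n)
  2^1+R≤n : 2 * 2 ^ R ≤ n
  2^1+R≤n rewrite 2^R≡1+k = 2k≤n

¬2≤ᵇ⇒≤1 : ∀ m → not (2 ≤ᵇ m) ≡ true → m ≤ 1
¬2≤ᵇ⇒≤1 zero          _ = z≤n
¬2≤ᵇ⇒≤1 (suc zero)    _ = s≤s z≤n
¬2≤ᵇ⇒≤1 (suc (suc m)) ()

noEdges : ∀ {n} → Fin n → Bool
noEdges _ = false

module _ {n} {G : Graph n} where

  selectParts : ∀ {k} → Parts G k → (S : Fin k → Bool) → Parts G (countTrue S)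
  selectParts P S = record
    { mem       = mem P ∘ select S
    ; disjoint  = λ i j v i≢j → disjoint P _ _ v (i≢j ∘ select-injective S)
    ; nonempty  = nonempty P ∘ select S
    ; connected = connected P ∘ select S
    }

  ∑size≤n : ∀ {k} (P : Parts G k) → ∑[ i < k ] countTrue (mem P i) ≤ n
  ∑size≤n {k} P = begin
    ∑[ i < k ] countTrue (mem P i)                  ≡⟨ sum-cong-≗ (countTrue≡sum ∘ mem P) ⟩
    ∑[ i < k ] ∑[ v < n ] [ i ∋ v ]                 ≡⟨ ∑-comm (λ i v → [ i ∋ v ]) ⟩
    ∑[ v < n ] ∑[ i < k ] [ i ∋ v ]                 ≡⟨ sum-cong-≗ (λ v → sym (countTrue≡sum (λ i → mem P i v))) ⟩
    ∑[ v < n ] countTrue (λ i → mem P i v)          ≤⟨ sum-mono-≤ (λ v → countTrue≤1 _ (λ i j i≢j → disjoint P i j v i≢j)) ⟩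
    ∑[ v < n ] 1                                    ≡⟨ sum-const n 1 ⟩
    n * 1                                           ≡⟨ *-identityʳ n ⟩
    n                                               ∎
    where
    open ≤-Reasoning
    [_∋_] : Fin k → Fin n → ℕ
    [ i ∋ v ] = if mem P i v then 1 else 0

  2*#parts≤n : ∀ {k} (P : Parts G k) → (∀ i → 2 ≤ countTrue (mem P i)) → 2 * k ≤ n
  2*#parts≤n {k} P 2≤size = begin
    2 * k                              ≡⟨ *-comm 2 k ⟩
    k * 2                              ≡⟨ sum-const k 2 ⟨
    ∑[ i < k ] 2                       ≤⟨ sum-mono-≤ 2≤size ⟩
    ∑[ i < k ] countTrue (mem P i)     ≤⟨ ∑size≤n P ⟩
    n                                  ∎
    where open ≤-Reasoning

  isLarge : ∀ {k} → Parts G k → Fin k → Bool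
  isLarge P i = 2 ≤ᵇ countTrue (mem P i)

  2*#large≤n : ∀ {k} (P : Parts G k) → 2 * countTrue (isLarge P) ≤ n
  2*#large≤n P = 2*#parts≤n (selectParts P (isLarge P))
    (λ j → ≤ᵇ⇒≤ 2 _ (Equivalence.from T-≡ (select-true (isLarge P) j)))

module _ {n} {G : Graph n} {D} (T : RootedSpanningTree G D) where

  weakenCongestion : ∀ {k} {P : Parts G k} {I C C′ b} →
    (∀ {m} → C m → C′ m) → Shortcut T P I C b → Shortcut T P I C′ b
  weakenCongestion C⇒C′ Sc = record
    { H = H ; H-tree = H-tree ; congestion = λ v v≢root → C⇒C′ (congestion v v≢root) ; blocks = blocks }
    where open Shortcut Sc

  emptyShortcut : ∀ {k} {P : Parts G k} {I b} →
    (∀ i → I i ≡ true → AtMostBlocks T (mem P i) noEdges b) → Shortcut T P I (_≤ 0) b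
  emptyShortcut {I = I} blocks = record
    { H          = λ _ → noEdges
    ; H-tree     = λ _ → refl
    ; congestion = λ _ _ → ≤-reflexive (countTrue-none _ (∧-zeroʳ ∘ I))
    ; blocks     = blocks
    }

  singletonBlocks : ∀ {p : Fin n → Bool} {b} → 1 ≤ b → countTrue p ≤ 1 →
    Σ (Fin n) (λ v → p v ≡ true) → AtMostBlocks T p noEdges b
  singletonBlocks {p} 1≤b ≤1 (v , pv) = v ∷ [] , 1≤b , inj₁ pv ∷ [] , represent
    where
    represent : ∀ x → InVert T p noEdges x → Σ (Fin n) λ r → r ∈ v ∷ [] × Star (HEdge T noEdges) x r
    represent x (inj₁ px) rewrite countTrue≤1⇒unique p ≤1 px pv = v , here refl , ε
    represent x (inj₂ (_ , inj₁ (() , _)))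
    represent x (inj₂ (_ , inj₂ (() , _)))

  liftShortcut : ∀ {k} {P : Parts G k} {S C b} →
    Shortcut T (selectParts P S) (λ _ → true) C b → Shortcut T P S C b
  liftShortcut {P = P} {S} {C} {b} Sc = record
    { H          = H′
    ; H-tree     = H′-tree
    ; congestion = λ v v≢root →
        subst C (sym (countTrue-extend S (λ h → h v) H noEdges)) (congestion v v≢root)
    ; blocks     = extend-selected S H noEdges (λ i h → AtMostBlocks T (mem P i) h b) (λ j → blocks j refl)
    }
    where
    open Shortcut Sc
    H′ : Fin _ → Fin n → Bool
    H′ = extend S H noEdges
    H′-tree : ∀ i → H′ i (root T) ≡ false
    H′-tree i with S i in Si
    ... | true  = extend-selected S H noEdges (λ _ h → h (root T) ≡ false) H-tree i Si
    ... | false = cong (λ h → h (root T)) (extend-unselected S H noEdges i Si)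

  mergeShortcut : ∀ {k} {P : Parts G k} {I c₁ c₂ b} →
    Shortcut T P I (_≤ c₁) b → Shortcut T P (not ∘ I) (_≤ c₂) b →
    Shortcut T P (λ _ → true) (_≤ c₁ + c₂) b
  mergeShortcut {P = P} {I} {c₁} {c₂} {b} S₁ S₂ = record
    { H = H ; H-tree = H-tree ; congestion = congestion ; blocks = blocks }
    where
    module S₁ = Shortcut S₁
    module S₂ = Shortcut S₂
    H : Fin _ → Fin n → Bool
    H i v = if I i then S₁.H i v else S₂.H i v
    H-tree : ∀ i → H i (root T) ≡ false
    H-tree i with I i
    ... | true  = S₁.H-tree i
    ... | false = S₂.H-tree i
    congestion : ∀ v → v ≢ root T → countTrue (λ i → H i v) ≤ c₁ + c₂
    congestion v v≢root = ≤-trans (≤-reflexive (countTrue-if I (λ i → S₁.H i v) (λ i → S₂.H i v)))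
      (+-mono-≤ (S₁.congestion v v≢root) (S₂.congestion v v≢root))
    blocks : ∀ i → true ≡ true → AtMostBlocks T (mem P i) (H i) b
    blocks i _ with I i in Ii
    ... | true  = S₁.blocks i Ii
    ... | false = S₂.blocks i (cong not Ii)

  wholeGraph : Connected G → Parts G 1
  wholeGraph conn = record
    { mem       = λ _ _ → true
    ; disjoint  = λ { zero zero _ 0≢0 _ → contradiction refl 0≢0 }
    ; nonempty  = λ _ → root T , refl
    ; connected = λ _ u v _ _ → gmap id (λ uv → uv , refl , refl) (conn u v)
    }

  partial⇒1≤b : ∀ {C b} → Connected G → AdmitsPartialShortcuts G D C b → 1 ≤ b
  partial⇒1≤b conn partial with partial T 1 (wholeGraph conn)
  ... | I , 1≤2#I , Sc with I zero in I0
  ...   | false = contradiction 1≤2#I λ ()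
  ...   | true with Shortcut.blocks Sc zero I0
  ...     | reps , #reps≤b , _ , represent with represent (root T) (inj₁ refl)
  ...       | _ , r∈reps , _ = ≤-trans (∈-length r∈reps) #reps≤b

  shortcut-<2^ : ∀ {c b} → AdmitsPartialShortcuts G D (_≤ c) b →
    ∀ R {k} (P : Parts G k) → k < 2 ^ R → Shortcut T P (λ _ → true) (_≤ R * c) b
  shortcut-<2^ partial zero {zero} P _ = emptyShortcut λ ()
  shortcut-<2^ partial zero {suc _} P (s≤s ())
  shortcut-<2^ partial (suc R) {k} P k<2^1+R with partial T k P
  ... | I , k≤2#I , S₁ = mergeShortcut S₁ (liftShortcut (shortcut-<2^ partial R (selectParts P (not ∘ I)) rest<2^R))
    where
    rest<2^R : countTrue (not ∘ I) < 2 ^ R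
    rest<2^R = complement-< (countTrue-not I) k≤2#I k<2^1+R

mainTheorem8 : (n : ℕ) (G : Graph n) (D c b : ℕ) →
    Connected G → IsDiameter G D →
    AdmitsPartialShortcuts G D (λ m → m ≤ c) b →
    AdmitsShortcuts G D (λ m → 2 ^ m ≤ n ^ c) b
mainTheorem8 n G D c b conn _ partial T k P
  with 2^-between (≤-<-trans z≤n (toℕ<n (root T))) (2*#large≤n P)
... | R , #large<2^R , 2^R≤n =
  weakenCongestion T 2^-bound (mergeShortcut T
    (liftShortcut T (shortcut-<2^ T partial R (selectParts P (isLarge P)) #large<2^R))
    (emptyShortcut T small))
  where
  small : ∀ i → not (isLarge P i) ≡ true → AtMostBlocks T (mem P i) noEdges b
  small i ¬large =
    singletonBlocks T (partial⇒1≤b T conn partial) (¬2≤ᵇ⇒≤1 _ ¬large) (nonempty P i)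
  2^-bound : ∀ {m} → m ≤ R * c + 0 → 2 ^ m ≤ n ^ c
  2^-bound {m} m≤Rc = begin
    2 ^ m        ≤⟨ ^-monoʳ-≤ 2 (≤-trans m≤Rc (≤-reflexive (+-identityʳ (R * c)))) ⟩
    2 ^ (R * c)  ≡⟨ ^-*-assoc 2 R c ⟨
    (2 ^ R) ^ c  ≤⟨ ^-monoˡ-≤ c 2^R≤n ⟩
    n ^ c        ∎
    where open ≤-Reasoning
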